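{- Let $G$ be a finite abelian group, $H$ a subgroup of $G$, $M=G/H$, and let $\rho:\mathbb{Z}[G]\to\mathbb{Z}[M]$ be the ring homomorphism induced by the canonical epimorphism $G\to M$. If $D$ is a $(v,k,\lambda)$ difference set of order $n$ in $G$ (viewed as the group ring element $\sum_{g\in D}g$) and $\rho(D)=\sum_{m\in M} a_m m\in\mathbb{Z}[M]$, then $$a_m\leq \frac{k+(|M|-1)\sqrt{n}}{|M|}$$ for all $m\in M$.
   Context: A $(v,k,\lambda)$ difference set $D$ is a $k$-subset of an abelian group $G$ of order $v$ such that every non-identity element of $G$ can be written as $d_1d_2^{ -1}$ with $d_1,d_2\in D$ in exactly $\lambda$ ways; its order is $n=k-\lambda$. -}

module Defs where

open import Data.Nat using (ℕ)
open import Data.Bool using (Bool; true; _∧_)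
open import Data.List using (List; length; filterᵇ; cartesianProduct)
open import Data.List.Membership.Propositional using (_∈_)
open import Data.List.Relation.Unary.Unique.Propositional using (Unique)
open import Data.Product using (_×_; _,_)
open import Relation.Binary.PropositionalEquality using (_≡_; _≢_)
open import Relation.Binary.Definitions using (DecidableEquality)
open import Relation.Nullary.Decidable using (⌊_⌋)
open import Algebra.Structures using (IsAbelianGroup)

record FinAbGroup : Set₁ where
  infixl 7 _∙_
  field
    Carrier        : Set
    _∙_            : Carrier → Carrier → Carrier
    ε              : Carrier
    _⁻¹            : Carrier → Carrier
    isAbelianGroup : IsAbelianGroup _≡_ _∙_ ε _⁻¹
    _≟_            : DecidableEquality Carrier
    elems          : List Carrier
    complete       : ∀ x → x ∈ elems
    unique         : Unique elems

  order : ℕ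
  order = length elems

  size : (Carrier → Bool) → ℕ
  size P = length (filterᵇ P elems)

  reps : (Carrier → Bool) → Carrier → ℕ
  reps D g = length (filterᵇ (λ p → pr p) (cartesianProduct elems elems))
    where
    pr : Carrier × Carrier → Bool
    pr (d₁ , d₂) = D d₁ ∧ D d₂ ∧ ⌊ (d₁ ∙ (d₂ ⁻¹)) ≟ g ⌋

  record IsDifferenceSet (D : Carrier → Bool) (v k lam : ℕ) : Set where
    field
      order≡v : order ≡ v
      size≡k  : size D ≡ k
      reps≡λ  : ∀ g → g ≢ ε → reps D g ≡ lam

  record IsSubgroup (H : Carrier → Bool) : Set where
    field
      ε∈H  : H ε ≡ true
      ∙∈H  : ∀ x y → H x ≡ true → H y ≡ true → H (x ∙ y) ≡ true
      ⁻¹∈H : ∀ x → H x ≡ true → H (x ⁻¹) ≡ true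

  -- Coefficient of the coset m = gH in ρ(D) ∈ ℤ[G/H], where ρ is induced by
  -- G → G/H: the number of d ∈ D with ρ(d) = gH, i.e. with g⁻¹ d ∈ H.
  cosetCoeff : (H D : Carrier → Bool) → Carrier → ℕ
  cosetCoeff H D g = size (λ d → D d ∧ H ((g ⁻¹) ∙ d))

{-# OPTIONS --safe #-}
module Submission where

-- Let a_x be the coefficient of the coset xH in ρ(D), s = |H| and m = M − 1. Summing over G counts
-- every coset s times, so ∑ₓ a_x = s k and ∑ₓ a_x² = s ∑_{d ∈ D} a_d; counting the pairs
-- (d₁ , d₂) ∈ D² with d₁ d₂⁻¹ ∈ H gives ∑_{d ∈ D} a_d = n + λ s, and counting all pairs gives
-- k² = n + λ v. For a fixed coset gH let a = a_g, and let b and c be the sum and the sum of squares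
-- of the coefficients of the other m cosets: then a + b = k, a² + c = n + λ s, and Cauchy–Schwarz
-- gives b² ≤ m c. Eliminating λ, M (a² + c) = m n + k², and then
-- M (m c − b²) = m² n − (M a − k)², whence (M a − k)² ≤ m² n.

open import Defs
open import Algebra.Bundles using (AbelianGroup)
open import Algebra.Structures using (IsAbelianGroup)
open import Data.Bool using (Bool; true; false; _∧_; not; T; T?)
open import Data.Bool.Properties using (⇔→≡)
open import Data.List using (List; []; _∷_; length; filterᵇ; map; _++_; cartesianProduct)
open import Data.List.Membership.Propositional using (_∈_)
open import Data.List.Membership.Propositional.Properties using (∈-filter⁺; ∈-length)
open import Data.List.Properties using (length-filter)
open import Data.List.Relation.Unary.All as All using (All; []; _∷_)
open import Data.List.Relation.Unary.AllPairs using (_∷_)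
open import Data.List.Relation.Unary.Any using (here; there)
open import Data.List.Relation.Unary.Unique.Propositional using (Unique)
open import Data.Nat using (ℕ; zero; suc; _+_; _*_; _∸_; _^_; _≤_; _<_; z≤n; s≤s; NonZero; >-nonZero; _≤?_)
open import Data.Nat.Properties hiding (_≟_)
open import Data.Nat.Tactic.RingSolver using (solve-∀)
open import Data.Product using (_×_; _,_)
open import Data.Unit using (tt)
open import Data.Sum using ([_,_]′)
open import Function using (_∘_; mk⇔)
open import Relation.Binary.Definitions using (DecidableEquality)
open import Relation.Binary.PropositionalEquality
open import Relation.Nullary using (yes; no; contradiction)
open import Relation.Nullary.Decidable using (⌊_⌋)
open import Algebra.Properties.CommutativeSemigroup +-commutativeSemigroup using (interchange)
open import Algebra.Properties.CommutativeSemigroup *-commutativeSemigroup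
  using () renaming (x∙yz≈y∙xz to x*[y*z]≡y*[x*z])

⟦_⟧ : Bool → ℕ
⟦ true  ⟧ = 1
⟦ false ⟧ = 0

⟦⟧-∧ : ∀ b c → ⟦ b ∧ c ⟧ ≡ ⟦ b ⟧ * ⟦ c ⟧
⟦⟧-∧ true  c = sym (*-identityˡ ⟦ c ⟧)
⟦⟧-∧ false c = refl

⟦⟧+⟦not⟧ : ∀ b → ⟦ b ⟧ + ⟦ not b ⟧ ≡ 1
⟦⟧+⟦not⟧ true  = refl
⟦⟧+⟦not⟧ false = refl

⟦⟧-idem : ∀ b → ⟦ b ⟧ * ⟦ b ⟧ ≡ ⟦ b ⟧
⟦⟧-idem true  = refl
⟦⟧-idem false = refl

module _ {A : Set} where

  ∑ : List A → (A → ℕ) → ℕ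
  ∑ []       f = 0
  ∑ (x ∷ xs) f = f x + ∑ xs f

  infixr 8 ∑
  syntax ∑ xs (λ x → e) = ∑[ x ∈ xs ] e

  ∑-cong : ∀ xs {f g : A → ℕ} → (∀ x → f x ≡ g x) → ∑ xs f ≡ ∑ xs g
  ∑-cong []       f≗g = refl
  ∑-cong (x ∷ xs) f≗g = cong₂ _+_ (f≗g x) (∑-cong xs f≗g)

  ∑-mono-≤ : ∀ xs {f g : A → ℕ} → (∀ x → f x ≤ g x) → ∑ xs f ≤ ∑ xs g
  ∑-mono-≤ []       f≤g = z≤n
  ∑-mono-≤ (x ∷ xs) f≤g = +-mono-≤ (f≤g x) (∑-mono-≤ xs f≤g)

  ∑-zero : ∀ xs → ∑[ x ∈ xs ] 0 ≡ 0
  ∑-zero []       = refl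
  ∑-zero (x ∷ xs) = ∑-zero xs

  ∑-length : ∀ xs → ∑[ x ∈ xs ] 1 ≡ length xs
  ∑-length []       = refl
  ∑-length (x ∷ xs) = cong suc (∑-length xs)

  ∑-distrib-+ : ∀ xs (f g : A → ℕ) → ∑[ x ∈ xs ] (f x + g x) ≡ ∑ xs f + ∑ xs g
  ∑-distrib-+ []       f g = refl
  ∑-distrib-+ (x ∷ xs) f g =
    trans (cong (f x + g x +_) (∑-distrib-+ xs f g)) (interchange (f x) (g x) (∑ xs f) (∑ xs g))

  *-distribˡ-∑ : ∀ c xs (f : A → ℕ) → c * ∑ xs f ≡ ∑[ x ∈ xs ] (c * f x)
  *-distribˡ-∑ c []       f = *-zeroʳ c
  *-distribˡ-∑ c (x ∷ xs) f =
    trans (*-distribˡ-+ c (f x) (∑ xs f)) (cong (c * f x +_) (*-distribˡ-∑ c xs f))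

  *-distribʳ-∑ : ∀ c xs (f : A → ℕ) → ∑ xs f * c ≡ ∑[ x ∈ xs ] (f x * c)
  *-distribʳ-∑ c xs f =
    trans (*-comm (∑ xs f) c) (trans (*-distribˡ-∑ c xs f) (∑-cong xs (λ x → *-comm c (f x))))

  ∑-partition : ∀ xs (p : A → Bool) (f : A → ℕ) →
                ∑ xs f ≡ ∑[ x ∈ xs ] (⟦ p x ⟧ * f x) + ∑[ x ∈ xs ] (⟦ not (p x) ⟧ * f x)
  ∑-partition xs p f = trans (∑-cong xs split) (∑-distrib-+ xs _ _)
    where
    split : ∀ x → f x ≡ ⟦ p x ⟧ * f x + ⟦ not (p x) ⟧ * f x
    split x = begin
      f x                                    ≡⟨ *-identityˡ (f x) ⟨
      1 * f x                                ≡⟨ cong (_* f x) (⟦⟧+⟦not⟧ (p x)) ⟨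
      (⟦ p x ⟧ + ⟦ not (p x) ⟧) * f x        ≡⟨ *-distribʳ-+ (f x) ⟦ p x ⟧ _ ⟩
      ⟦ p x ⟧ * f x + ⟦ not (p x) ⟧ * f x    ∎
      where open ≡-Reasoning

  ∑-++ : ∀ (xs ys : List A) f → ∑ (xs ++ ys) f ≡ ∑ xs f + ∑ ys f
  ∑-++ []       ys f = refl
  ∑-++ (x ∷ xs) ys f = trans (cong (f x +_) (∑-++ xs ys f)) (sym (+-assoc (f x) _ _))

  length-filterᵇ : ∀ (p : A → Bool) xs → length (filterᵇ p xs) ≡ ∑[ x ∈ xs ] ⟦ p x ⟧
  length-filterᵇ p []       = refl
  length-filterᵇ p (x ∷ xs) with p x
  ... | true  = cong suc (length-filterᵇ p xs)
  ... | false = length-filterᵇ p xs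

∑-map : ∀ {A B : Set} (g : A → B) xs f → ∑ (map g xs) f ≡ ∑[ x ∈ xs ] f (g x)
∑-map g []       f = refl
∑-map g (x ∷ xs) f = cong (f (g x) +_) (∑-map g xs f)

module _ {A B : Set} where

  ∑-cartesianProduct : ∀ (xs : List A) (ys : List B) f →
                       ∑ (cartesianProduct xs ys) f ≡ ∑[ x ∈ xs ] ∑[ y ∈ ys ] f (x , y)
  ∑-cartesianProduct []       ys f = refl
  ∑-cartesianProduct (x ∷ xs) ys f =
    trans (∑-++ (map (x ,_) ys) _ f) (cong₂ _+_ (∑-map (x ,_) ys f) (∑-cartesianProduct xs ys f))

  ∑-comm : ∀ (xs : List A) (ys : List B) (f : A → B → ℕ) →
           ∑[ x ∈ xs ] ∑[ y ∈ ys ] f x y ≡ ∑[ y ∈ ys ] ∑[ x ∈ xs ] f x y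
  ∑-comm []       ys f = sym (∑-zero ys)
  ∑-comm (x ∷ xs) ys f =
    trans (cong (∑ ys (f x) +_) (∑-comm xs ys f)) (sym (∑-distrib-+ ys (f x) _))

  ∑-*-∑ : ∀ (xs : List A) (ys : List B) f g →
          ∑ xs f * ∑ ys g ≡ ∑[ x ∈ xs ] ∑[ y ∈ ys ] (f x * g y)
  ∑-*-∑ xs ys f g =
    trans (*-distribʳ-∑ (∑ ys g) xs f) (∑-cong xs (λ x → *-distribˡ-∑ (f x) ys g))

  ∑∑-distrib-+ : ∀ (xs : List A) (ys : List B) (f g : A → B → ℕ) →
                 ∑[ x ∈ xs ] ∑[ y ∈ ys ] (f x y + g x y)
                   ≡ ∑[ x ∈ xs ] ∑[ y ∈ ys ] f x y + ∑[ x ∈ xs ] ∑[ y ∈ ys ] g x y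
  ∑∑-distrib-+ xs ys f g =
    trans (∑-cong xs (λ x → ∑-distrib-+ ys (f x) (g x))) (∑-distrib-+ xs _ _)

  *-distribˡ-∑∑ : ∀ c (xs : List A) (ys : List B) (f : A → B → ℕ) →
                  c * ∑[ x ∈ xs ] ∑[ y ∈ ys ] f x y ≡ ∑[ x ∈ xs ] ∑[ y ∈ ys ] (c * f x y)
  *-distribˡ-∑∑ c xs ys f =
    trans (*-distribˡ-∑ c xs _) (∑-cong xs (λ x → *-distribˡ-∑ c ys (f x)))

am-gm : ∀ m n → 2 * (m * n) ≤ m * m + n * n
am-gm m n = [ ordered , swapped ]′ (≤-total m n)
  where
  ordered : ∀ {m n} → m ≤ n → 2 * (m * n) ≤ m * m + n * n
  ordered {m} m≤n with d , refl ← m≤n⇒∃[o]m+o≡n m≤n =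
    subst (2 * (m * (m + d)) ≤_) (gap m d) (m≤m+n _ (d * d))
    where
    gap : ∀ m d → 2 * (m * (m + d)) + d * d ≡ m * m + (m + d) * (m + d)
    gap = solve-∀
  swapped : n ≤ m → 2 * (m * n) ≤ m * m + n * n
  swapped n≤m = subst₂ _≤_ (cong (2 *_) (*-comm n m)) (+-comm (n * n) (m * m)) (ordered n≤m)

cauchy-schwarz : ∀ {A : Set} (xs : List A) (w f : A → ℕ) →
                 ∑[ x ∈ xs ] (w x * f x) * ∑[ x ∈ xs ] (w x * f x)
                   ≤ ∑ xs w * ∑[ x ∈ xs ] (w x * (f x * f x))
cauchy-schwarz {A} xs w f = *-cancelˡ-≤ 2 (begin
  2 * (∑ xs wf * ∑ xs wf)                             ≡⟨ cong (2 *_) (∑-*-∑ xs xs wf wf) ⟩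
  2 * ∑[ x ∈ xs ] ∑[ y ∈ xs ] (wf x * wf y)            ≡⟨ *-distribˡ-∑∑ 2 xs xs _ ⟩
  ∑[ x ∈ xs ] ∑[ y ∈ xs ] (2 * (wf x * wf y))          ≤⟨ ∑-mono-≤ xs (λ x → ∑-mono-≤ xs (pointwise x)) ⟩
  ∑[ x ∈ xs ] ∑[ y ∈ xs ] (wf² x * w y + w x * wf² y)  ≡⟨ ∑∑-distrib-+ xs xs _ _ ⟩
  ∑[ x ∈ xs ] ∑[ y ∈ xs ] (wf² x * w y) + ∑[ x ∈ xs ] ∑[ y ∈ xs ] (w x * wf² y)
    ≡⟨ cong₂ _+_ (∑-*-∑ xs xs wf² w) (∑-*-∑ xs xs w wf²) ⟨
  ∑ xs wf² * ∑ xs w + ∑ xs w * ∑ xs wf²               ≡⟨ double (∑ xs wf²) (∑ xs w) ⟩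
  2 * (∑ xs w * ∑ xs wf²)                             ∎)
  where
  open ≤-Reasoning
  wf wf² : A → ℕ
  wf  x = w x * f x
  wf² x = w x * (f x * f x)

  pointwise : ∀ x y → 2 * (wf x * wf y) ≤ wf² x * w y + w x * wf² y
  pointwise x y = subst₂ _≤_ (regroup (w x) (w y) (f x) (f y)) (expand (w x) (w y) (f x) (f y))
                    (*-monoʳ-≤ (w x * w y) (am-gm (f x) (f y)))
    where
    regroup : ∀ a b c d → (a * b) * (2 * (c * d)) ≡ 2 * ((a * c) * (b * d))
    regroup = solve-∀
    expand : ∀ a b c d → (a * b) * (c * c + d * d) ≡ a * (c * c) * b + a * (b * (d * d))
    expand = solve-∀

  double : ∀ q w → q * w + w * q ≡ 2 * (w * q)
  double = solve-∀

module Enumeration {A : Set} (_≟_ : DecidableEquality A)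
                   {xs : List A} (unique : Unique xs) (complete : ∀ x → x ∈ xs) where

  δ : A → A → ℕ
  δ x y = ⟦ ⌊ x ≟ y ⌋ ⟧

  δ-refl : ∀ x → δ x x ≡ 1
  δ-refl x with x ≟ x
  ... | yes _   = refl
  ... | no  x≢x = contradiction refl x≢x

  δ-≢ : ∀ {x y} → x ≢ y → δ x y ≡ 0
  δ-≢ {x} {y} x≢y with x ≟ y
  ... | yes x≡y = contradiction x≡y x≢y
  ... | no  _   = refl

  δ-⇔ : ∀ {x y x′ y′} → (x ≡ y → x′ ≡ y′) → (x′ ≡ y′ → x ≡ y) → δ x y ≡ δ x′ y′
  δ-⇔ {x} {y} {x′} {y′} to from with x ≟ y | x′ ≟ y′
  ... | yes _   | yes _     = refl
  ... | no  _   | no  _     = refl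
  ... | yes x≡y | no  x′≢y′ = contradiction (to x≡y) x′≢y′
  ... | no  x≢y | yes x′≡y′ = contradiction (from x′≡y′) x≢y

  ∑-δ : ∀ y (f : A → ℕ) → ∑[ x ∈ xs ] (δ y x * f x) ≡ f y
  ∑-δ y f = go unique (complete y)
    where
    absent : ∀ {ys} → All (y ≢_) ys → ∑[ x ∈ ys ] (δ y x * f x) ≡ 0
    absent []            = refl
    absent (y≢x ∷ y∉ys) rewrite δ-≢ y≢x = absent y∉ys

    go : ∀ {ys} → Unique ys → y ∈ ys → ∑[ x ∈ ys ] (δ y x * f x) ≡ f y
    go (y∉ys ∷ _) (here refl) rewrite δ-refl y | absent y∉ys = trans (+-identityʳ _) (+-identityʳ _)
    go (x∉ys ∷ u) (there y∈ys) rewrite δ-≢ (λ y≡x → All.lookup x∉ys y∈ys (sym y≡x)) = go u y∈ys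

  ∑-reindex : ∀ (φ ψ : A → A) → (∀ x → ψ (φ x) ≡ x) → (∀ y → φ (ψ y) ≡ y) →
              ∀ f → ∑[ x ∈ xs ] f (φ x) ≡ ∑ xs f
  ∑-reindex φ ψ ψ∘φ φ∘ψ f = begin
    ∑[ x ∈ xs ] f (φ x)
      ≡⟨ ∑-cong xs (λ x → ∑-δ (φ x) f) ⟨
    ∑[ x ∈ xs ] ∑[ y ∈ xs ] (δ (φ x) y * f y)
      ≡⟨ ∑-comm xs xs _ ⟩
    ∑[ y ∈ xs ] ∑[ x ∈ xs ] (δ (φ x) y * f y)
      ≡⟨ ∑-cong xs (λ y → ∑-cong xs (λ x → cong (_* f y) (transpose x y))) ⟩
    ∑[ y ∈ xs ] ∑[ x ∈ xs ] (δ (ψ y) x * f y)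
      ≡⟨ ∑-cong xs (λ y → ∑-δ (ψ y) (λ _ → f y)) ⟩
    ∑ xs f ∎
    where
    open ≡-Reasoning
    transpose : ∀ x y → δ (φ x) y ≡ δ (ψ y) x
    transpose x y = δ-⇔ (λ φx≡y → trans (cong ψ (sym φx≡y)) (ψ∘φ x))
                        (λ ψy≡x → trans (cong φ (sym ψy≡x)) (φ∘ψ y))

≤-from-scaled : ∀ s {x y z} .{{_ : NonZero s}} → s * x ≡ s * y + z → y ≤ x
≤-from-scaled s {y = y} {z} eq = *-cancelˡ-≤ s (subst (s * y ≤_) (sym eq) (m≤m+n (s * y) z))

∸-from-scaled : ∀ s {x y z} → s * x ≡ s * y + z → z ≡ s * (x ∸ y)
∸-from-scaled s {x} {y} {z} eq = begin
  z                   ≡⟨ m+n∸m≡n (s * y) z ⟨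
  s * y + z ∸ s * y   ≡⟨ cong (_∸ s * y) eq ⟨
  s * x ∸ s * y       ≡⟨ *-distribˡ-∸ s x y ⟨
  s * (x ∸ y)         ∎
  where open ≡-Reasoning

-- For v = 1 the difference-set condition is vacuous and lam is arbitrary.
lam≤k : ∀ {k v lam} → k ≤ v → 2 ≤ v → k * k + lam ≡ lam * v + k → lam ≤ k
lam≤k {k} {suc (suc v)} {lam} k≤v (s≤s (s≤s z≤n)) eq with lam ≤? k
... | yes lam≤k = lam≤k
... | no  lam≰k = contradiction k*k≡ (<⇒≢ k*k<)
  where
  open ≤-Reasoning
  k*k< : k * k < k + lam * suc v
  k*k< = begin-strict
    k * k                  ≤⟨ *-monoʳ-≤ k k≤v ⟩
    k * suc (suc v)        ≡⟨ *-suc k (suc v) ⟩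
    k + k * suc v          <⟨ +-monoʳ-< k (*-monoˡ-< (suc v) (≰⇒> lam≰k)) ⟩
    k + lam * suc v        ∎
  rearrange : ∀ lam v k → lam * suc (suc v) + k ≡ k + lam * suc v + lam
  rearrange = solve-∀
  k*k≡ : k * k ≡ k + lam * suc v
  k*k≡ = +-cancelʳ-≡ lam _ _ (trans eq (rearrange lam v k))

square-identity : ∀ m a b e → m * a ≡ b + e →
                  e * e + m * ((a + b) * (a + b)) ≡ m * (suc m * (a * a)) + suc m * (b * b)
square-identity m a b e ma≡b+e = begin
  e * e + m * ((a + b) * (a + b))      ≡⟨ expandˡ m a b e ⟩
  L (m * a)                            ≡⟨ cong L ma≡b+e ⟩
  L (b + e)                            ≡⟨ middle m a b e ⟩
  R (b + e)                            ≡⟨ cong R ma≡b+e ⟨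
  R (m * a)                            ≡⟨ expandʳ m a b ⟩
  m * (suc m * (a * a)) + suc m * (b * b) ∎
  where
  open ≡-Reasoning
  -- Both sides are polynomials in p = m a, so the hypothesis can be substituted for p.
  L R : ℕ → ℕ
  L p = e * e + p * a + 2 * (p * b) + m * (b * b)
  R p = p * a + p * p + suc m * (b * b)
  expandˡ : ∀ m a b e → e * e + m * ((a + b) * (a + b)) ≡ e * e + m * a * a + 2 * (m * a * b) + m * (b * b)
  expandˡ = solve-∀
  middle : ∀ m a b e → e * e + (b + e) * a + 2 * ((b + e) * b) + m * (b * b)
                     ≡ (b + e) * a + (b + e) * (b + e) + suc m * (b * b)
  middle = solve-∀
  expandʳ : ∀ m a b → m * a * a + m * a * (m * a) + suc m * (b * b) ≡ m * (suc m * (a * a)) + suc m * (b * b)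
  expandʳ = solve-∀

excess-bound : ∀ m a b c n e → m * a ≡ b + e → suc m * (a * a + c) ≡ m * n + (a + b) * (a + b) →
               b * b ≤ m * c → e * e ≤ m * m * n
excess-bound m a b c n e ma≡b+e scaled-squares b²≤mc = +-cancelʳ-≤ (m * ((a + b) * (a + b))) _ _ (begin
  e * e + m * ((a + b) * (a + b))           ≡⟨ square-identity m a b e ma≡b+e ⟩
  m * (suc m * (a * a)) + suc m * (b * b)   ≤⟨ +-monoʳ-≤ (m * (suc m * (a * a))) (*-monoʳ-≤ (suc m) b²≤mc) ⟩
  m * (suc m * (a * a)) + suc m * (m * c)   ≡⟨ collect m a c ⟩
  m * (suc m * (a * a + c))                 ≡⟨ cong (m *_) scaled-squares ⟩
  m * (m * n + (a + b) * (a + b))           ≡⟨ spread m n (a + b) ⟩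
  m * m * n + m * ((a + b) * (a + b))       ∎)
  where
  open ≤-Reasoning
  collect : ∀ m a c → m * (suc m * (a * a)) + suc m * (m * c) ≡ m * (suc m * (a * a + c))
  collect = solve-∀
  spread : ∀ m n t → m * (m * n + t * t) ≡ m * m * n + m * (t * t)
  spread = solve-∀

-- b and c are the sum and the sum of squares of the coefficients of the m cosets other than gH.
coefficient-bound : ∀ m s a b c k lam .{{_ : NonZero s}} →
                    a + b ≡ k → a * a + c + lam ≡ lam * s + k → k * k + lam ≡ lam * (suc m * s) + k →
                    k ≤ suc m * s → b * b ≤ m * c → (suc m * a ∸ k) ^ 2 ≤ m ^ 2 * (k ∸ lam)
coefficient-bound m s a b c k lam a+b≡k coset-pairs all-pairs k≤v b²≤mc with suc m * a ≤? k
... | yes Ma≤k = subst (λ t → t ^ 2 ≤ m ^ 2 * (k ∸ lam)) (sym (m≤n⇒m∸n≡0 Ma≤k)) z≤n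
... | no  Ma≰k = subst₂ _≤_ (square e) (cong (_* n) (square m))
                   (excess-bound m a b c n e ma≡b+e scaled-squares b²≤mc)
  where
  open ≡-Reasoning
  square : ∀ x → x * x ≡ x ^ 2
  square x = cong (x *_) (sym (*-identityʳ x))

  e : ℕ
  e = suc m * a ∸ k

  ma≡b+e : m * a ≡ b + e
  ma≡b+e = +-cancelˡ-≡ a _ _ (begin
    suc m * a      ≡⟨ m+[n∸m]≡n (<⇒≤ (≰⇒> Ma≰k)) ⟨
    k + e          ≡⟨ cong (_+ e) a+b≡k ⟨
    a + b + e      ≡⟨ +-assoc a b e ⟩
    a + (b + e)    ∎)

  m≢0 : m ≢ 0
  m≢0 refl = Ma≰k (subst (_≤ k) (sym (*-identityˡ a)) (subst (a ≤_) a+b≡k (m≤m+n a b)))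

  2≤v : 2 ≤ suc m * s
  2≤v = ≤-trans (s≤s (n≢0⇒n>0 m≢0)) (m≤m*n (suc m) s)

  n : ℕ
  n = k ∸ lam

  n+lam≡k : n + lam ≡ k
  n+lam≡k = m∸n+n≡m (lam≤k k≤v 2≤v all-pairs)

  without-lam : ∀ {x y} → x + lam ≡ lam * y + k → x ≡ n + lam * y
  without-lam {x} {y} eq = +-cancelʳ-≡ lam _ _ (begin
    x + lam                ≡⟨ eq ⟩
    lam * y + k            ≡⟨ cong (lam * y +_) n+lam≡k ⟨
    lam * y + (n + lam)    ≡⟨ +-assoc (lam * y) n lam ⟨
    lam * y + n + lam      ≡⟨ cong (_+ lam) (+-comm (lam * y) n) ⟩
    n + lam * y + lam      ∎)

  redistribute : ∀ m n lam s → suc m * (n + lam * s) ≡ m * n + (n + lam * (suc m * s))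
  redistribute = solve-∀

  scaled-squares : suc m * (a * a + c) ≡ m * n + (a + b) * (a + b)
  scaled-squares = begin
    suc m * (a * a + c)               ≡⟨ cong (suc m *_) (without-lam coset-pairs) ⟩
    suc m * (n + lam * s)             ≡⟨ redistribute m n lam s ⟩
    m * n + (n + lam * (suc m * s))   ≡⟨ cong (m * n +_) (without-lam all-pairs) ⟨
    m * n + k * k                     ≡⟨ cong (λ t → m * n + t * t) a+b≡k ⟨
    m * n + (a + b) * (a + b)         ∎

-- s = |H|, a = a_g and P = ∑_{d ∈ D} a_d; S, N and Q are the sum of the coefficients, the number of
-- elements and the sum of the squared coefficients over G ∖ gH, in which every coset is counted s times.
coset-bound : ∀ s M a k lam v P S N Q .{{_ : NonZero s}} →
              M * s ≡ v → v ≡ s + N → s * k ≡ s * a + S → s * P ≡ s * (a * a) + Q → S * S ≤ N * Q →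
              P + lam ≡ lam * s + k → k * k + lam ≡ lam * v + k → k ≤ v →
              (M * a ∸ k) ^ 2 ≤ (M ∸ 1) ^ 2 * (k ∸ lam)
coset-bound s zero    a k lam v P S N Q _ _ _ _ _ _ _ _ rewrite 0∸n≡0 k = z≤n
coset-bound s (suc m) a k lam .(suc m * s) P S N Q refl count first second cs coset-pairs all-pairs k≤v =
  coefficient-bound m s a b c k lam (m+[n∸m]≡n a≤k)
    (trans (cong (_+ lam) (m+[n∸m]≡n (≤-from-scaled s second))) coset-pairs) all-pairs k≤v b²≤mc
  where
  a≤k : a ≤ k
  a≤k = ≤-from-scaled s first

  b c : ℕ
  b = k ∸ a
  c = P ∸ a * a

  regroup : ∀ m s c → m * s * (s * c) ≡ s * s * (m * c)
  regroup = solve-∀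

  b²≤mc : b * b ≤ m * c
  b²≤mc = *-cancelˡ-≤ (s * s) {{m*n≢0 s s}} (subst₂ _≤_
    (trans (cong (λ t → t * t) (∸-from-scaled s first)) ([m*n]*[o*p]≡[m*o]*[n*p] s b s b))
    (trans (cong₂ _*_ (+-cancelˡ-≡ s _ _ (sym count)) (∸-from-scaled s second)) (regroup m s c))
    cs)

module DifferenceSets (G : FinAbGroup) where
  open FinAbGroup G
  open IsAbelianGroup isAbelianGroup using (assoc; comm)
  open Enumeration _≟_ unique complete

  abelianGroup : AbelianGroup _ _
  abelianGroup = record { isAbelianGroup = isAbelianGroup }

  open import Algebra.Properties.AbelianGroup abelianGroup
    using (⁻¹-involutive; ⁻¹-anti-homo-\\; \\-leftDividesˡ; \\-leftDividesʳ; x∙y⁻¹≈ε⇒x≈y; x≈y⇒x∙y⁻¹≈ε)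

  module _ (D : Carrier → Bool) where

    reps≡∑ : ∀ u → reps D u ≡ ∑[ d₁ ∈ elems ] ∑[ d₂ ∈ elems ] (⟦ D d₁ ⟧ * (⟦ D d₂ ⟧ * δ (d₁ ∙ d₂ ⁻¹) u))
    reps≡∑ u = begin
      reps D u
        ≡⟨ length-filterᵇ _ (cartesianProduct elems elems) ⟩
      ∑[ p ∈ cartesianProduct elems elems ] ⟦ pairs p ⟧
        ≡⟨ ∑-cartesianProduct elems elems _ ⟩
      ∑[ d₁ ∈ elems ] ∑[ d₂ ∈ elems ] ⟦ D d₁ ∧ D d₂ ∧ ⌊ (d₁ ∙ d₂ ⁻¹) ≟ u ⌋ ⟧
        ≡⟨ ∑-cong elems (λ d₁ → ∑-cong elems λ d₂ → trans (⟦⟧-∧ (D d₁) _) (cong (⟦ D d₁ ⟧ *_) (⟦⟧-∧ (D d₂) _))) ⟩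
      ∑[ d₁ ∈ elems ] ∑[ d₂ ∈ elems ] (⟦ D d₁ ⟧ * (⟦ D d₂ ⟧ * δ (d₁ ∙ d₂ ⁻¹) u)) ∎
      where
      open ≡-Reasoning
      pairs : Carrier × Carrier → Bool
      pairs (d₁ , d₂) = D d₁ ∧ D d₂ ∧ ⌊ (d₁ ∙ d₂ ⁻¹) ≟ u ⌋

    ∑-reps : ∀ (F : Carrier → ℕ) → ∑[ u ∈ elems ] (F u * reps D u)
             ≡ ∑[ d₁ ∈ elems ] ∑[ d₂ ∈ elems ] (⟦ D d₁ ⟧ * (⟦ D d₂ ⟧ * F (d₁ ∙ d₂ ⁻¹)))
    ∑-reps F = begin
      ∑[ u ∈ elems ] (F u * reps D u)
        ≡⟨ ∑-cong elems (λ u → trans (cong (F u *_) (reps≡∑ u)) (*-distribˡ-∑∑ (F u) elems elems _)) ⟩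
      ∑[ u ∈ elems ] ∑[ d₁ ∈ elems ] ∑[ d₂ ∈ elems ] (F u * (⟦ D d₁ ⟧ * (⟦ D d₂ ⟧ * δ (d₁ ∙ d₂ ⁻¹) u)))
        ≡⟨ ∑-comm elems elems _ ⟩
      ∑[ d₁ ∈ elems ] ∑[ u ∈ elems ] ∑[ d₂ ∈ elems ] (F u * (⟦ D d₁ ⟧ * (⟦ D d₂ ⟧ * δ (d₁ ∙ d₂ ⁻¹) u)))
        ≡⟨ ∑-cong elems (λ d₁ → ∑-comm elems elems _) ⟩
      ∑[ d₁ ∈ elems ] ∑[ d₂ ∈ elems ] ∑[ u ∈ elems ] (F u * (⟦ D d₁ ⟧ * (⟦ D d₂ ⟧ * δ (d₁ ∙ d₂ ⁻¹) u)))
        ≡⟨ ∑-cong elems (λ d₁ → ∑-cong elems (λ d₂ → collapse ⟦ D d₁ ⟧ ⟦ D d₂ ⟧ (d₁ ∙ d₂ ⁻¹))) ⟩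
      ∑[ d₁ ∈ elems ] ∑[ d₂ ∈ elems ] (⟦ D d₁ ⟧ * (⟦ D d₂ ⟧ * F (d₁ ∙ d₂ ⁻¹))) ∎
      where
      open ≡-Reasoning
      reorder : ∀ f a b d → f * (a * (b * d)) ≡ a * (b * (d * f))
      reorder = solve-∀
      collapse : ∀ a b w → ∑[ u ∈ elems ] (F u * (a * (b * δ w u))) ≡ a * (b * F w)
      collapse a b w = begin
        ∑[ u ∈ elems ] (F u * (a * (b * δ w u)))  ≡⟨ ∑-cong elems (λ u → reorder (F u) a b (δ w u)) ⟩
        ∑[ u ∈ elems ] (a * (b * (δ w u * F u)))  ≡⟨ pull-out ⟨
        a * (b * ∑[ u ∈ elems ] (δ w u * F u))    ≡⟨ cong (λ t → a * (b * t)) (∑-δ w F) ⟩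
        a * (b * F w)                             ∎
        where
        pull-out : a * (b * ∑[ u ∈ elems ] (δ w u * F u)) ≡ ∑[ u ∈ elems ] (a * (b * (δ w u * F u)))
        pull-out = trans (cong (a *_) (*-distribˡ-∑ b elems _)) (*-distribˡ-∑ a elems _)

    reps-ε : reps D ε ≡ size D
    reps-ε = begin
      reps D ε
        ≡⟨ ∑-δ ε (reps D) ⟨
      ∑[ u ∈ elems ] (δ ε u * reps D u)
        ≡⟨ ∑-reps (δ ε) ⟩
      ∑[ d₁ ∈ elems ] ∑[ d₂ ∈ elems ] (⟦ D d₁ ⟧ * (⟦ D d₂ ⟧ * δ ε (d₁ ∙ d₂ ⁻¹)))
        ≡⟨ ∑-cong elems (λ d₁ → ∑-cong elems (λ d₂ → cong (⟦ D d₁ ⟧ *_) (diagonal d₁ d₂))) ⟩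
      ∑[ d₁ ∈ elems ] ∑[ d₂ ∈ elems ] (⟦ D d₁ ⟧ * (δ d₁ d₂ * ⟦ D d₂ ⟧))
        ≡⟨ ∑-cong elems (λ d₁ → trans (cong (⟦ D d₁ ⟧ *_) (sym (∑-δ d₁ (λ d → ⟦ D d ⟧)))) (*-distribˡ-∑ ⟦ D d₁ ⟧ elems _)) ⟨
      ∑[ d ∈ elems ] (⟦ D d ⟧ * ⟦ D d ⟧)
        ≡⟨ ∑-cong elems (λ d → ⟦⟧-idem (D d)) ⟩
      ∑[ d ∈ elems ] ⟦ D d ⟧
        ≡⟨ length-filterᵇ D elems ⟨
      size D ∎
      where
      open ≡-Reasoning
      diagonal : ∀ d₁ d₂ → ⟦ D d₂ ⟧ * δ ε (d₁ ∙ d₂ ⁻¹) ≡ δ d₁ d₂ * ⟦ D d₂ ⟧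
      diagonal d₁ d₂ = trans (*-comm ⟦ D d₂ ⟧ _) (cong (_* ⟦ D d₂ ⟧)
        (δ-⇔ (λ ε≡d₁/d₂ → x∙y⁻¹≈ε⇒x≈y d₁ d₂ (sym ε≡d₁/d₂)) (λ d₁≡d₂ → sym (x≈y⇒x∙y⁻¹≈ε d₁≡d₂))))

    module _ {v k lam} (isDifferenceSet : IsDifferenceSet D v k lam) where
      open IsDifferenceSet isDifferenceSet

      reps-split : ∀ u → reps D u + lam * δ ε u ≡ lam + k * δ ε u
      reps-split u with ε ≟ u
      ... | yes refl = trans (cong (_+ lam * 1) (trans reps-ε size≡k))
                             (trans (+-comm k (lam * 1)) (cong₂ _+_ (*-identityʳ lam) (sym (*-identityʳ k))))
      ... | no  ε≢u  = cong₂ _+_ (reps≡λ u (≢-sym ε≢u)) (trans (*-zeroʳ lam) (sym (*-zeroʳ k)))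

      ∑-weighted-reps : ∀ (w : Carrier → ℕ) →
                        ∑[ u ∈ elems ] (w u * reps D u) + lam * w ε ≡ lam * ∑ elems w + k * w ε
      ∑-weighted-reps w = begin
        ∑[ u ∈ elems ] (w u * reps D u) + lam * w ε
          ≡⟨ cong (λ t → ∑[ u ∈ elems ] (w u * reps D u) + lam * t) (∑-δ ε w) ⟨
        ∑[ u ∈ elems ] (w u * reps D u) + lam * ∑[ u ∈ elems ] (δ ε u * w u)
          ≡⟨ cong (∑[ u ∈ elems ] (w u * reps D u) +_) (*-distribˡ-∑ lam elems _) ⟩
        ∑[ u ∈ elems ] (w u * reps D u) + ∑[ u ∈ elems ] (lam * (δ ε u * w u))
          ≡⟨ ∑-distrib-+ elems _ _ ⟨
        ∑[ u ∈ elems ] (w u * reps D u + lam * (δ ε u * w u))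
          ≡⟨ ∑-cong elems weighted ⟩
        ∑[ u ∈ elems ] (lam * w u + k * (δ ε u * w u))
          ≡⟨ ∑-distrib-+ elems _ _ ⟩
        ∑[ u ∈ elems ] (lam * w u) + ∑[ u ∈ elems ] (k * (δ ε u * w u))
          ≡⟨ cong₂ _+_ (*-distribˡ-∑ lam elems w) (*-distribˡ-∑ k elems _) ⟨
        lam * ∑ elems w + k * ∑[ u ∈ elems ] (δ ε u * w u)
          ≡⟨ cong (λ t → lam * ∑ elems w + k * t) (∑-δ ε w) ⟩
        lam * ∑ elems w + k * w ε ∎
        where
        open ≡-Reasoning
        factor : ∀ w r l d → w * r + l * (d * w) ≡ w * (r + l * d)
        factor = solve-∀
        weighted : ∀ u → w u * reps D u + lam * (δ ε u * w u) ≡ lam * w u + k * (δ ε u * w u)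
        weighted u = begin
          w u * reps D u + lam * (δ ε u * w u)   ≡⟨ factor (w u) (reps D u) lam (δ ε u) ⟩
          w u * (reps D u + lam * δ ε u)         ≡⟨ cong (w u *_) (reps-split u) ⟩
          w u * (lam + k * δ ε u)                ≡⟨ factor (w u) lam k (δ ε u) ⟨
          w u * lam + k * (δ ε u * w u)          ≡⟨ cong (_+ k * (δ ε u * w u)) (*-comm (w u) lam) ⟩
          lam * w u + k * (δ ε u * w u)          ∎

      k≤v : k ≤ v
      k≤v = subst₂ _≤_ size≡k order≡v (length-filter (T? ∘ D) elems)

      k*k+lam≡lam*v+k : k * k + lam ≡ lam * v + k
      k*k+lam≡lam*v+k = begin
        k * k + lam                                  ≡⟨ cong₂ _+_ ∑-reps≡k² (*-identityʳ lam) ⟨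
        ∑[ u ∈ elems ] (1 * reps D u) + lam * 1      ≡⟨ ∑-weighted-reps (λ _ → 1) ⟩
        lam * ∑[ u ∈ elems ] 1 + k * 1
          ≡⟨ cong₂ (λ n t → lam * n + t) (trans (∑-length elems) order≡v) (*-identityʳ k) ⟩
        lam * v + k                                  ∎
        where
        open ≡-Reasoning
        ∑-reps≡k² : ∑[ u ∈ elems ] (1 * reps D u) ≡ k * k
        ∑-reps≡k² = begin
          ∑[ u ∈ elems ] (1 * reps D u)
            ≡⟨ ∑-reps (λ _ → 1) ⟩
          ∑[ d₁ ∈ elems ] ∑[ d₂ ∈ elems ] (⟦ D d₁ ⟧ * (⟦ D d₂ ⟧ * 1))
            ≡⟨ ∑-cong elems (λ d₁ → ∑-cong elems (λ d₂ → cong (⟦ D d₁ ⟧ *_) (*-identityʳ ⟦ D d₂ ⟧))) ⟩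
          ∑[ d₁ ∈ elems ] ∑[ d₂ ∈ elems ] (⟦ D d₁ ⟧ * ⟦ D d₂ ⟧)
            ≡⟨ ∑-*-∑ elems elems _ _ ⟨
          ∑[ d ∈ elems ] ⟦ D d ⟧ * ∑[ d ∈ elems ] ⟦ D d ⟧
            ≡⟨ cong (λ t → t * t) (trans (sym (length-filterᵇ D elems)) size≡k) ⟩
          k * k ∎

  module _ {H : Carrier → Bool} (isSubgroup : IsSubgroup H) where
    open IsSubgroup isSubgroup

    H-⁻¹ : ∀ x → H (x ⁻¹) ≡ H x
    H-⁻¹ x = ⇔→≡ (mk⇔ (λ h → subst (λ y → H y ≡ true) (⁻¹-involutive x) (⁻¹∈H _ h)) (⁻¹∈H x))

    H-∙ˡ : ∀ {x} y → H x ≡ true → H (x ∙ y) ≡ H y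
    H-∙ˡ {x} y hx =
      ⇔→≡ (mk⇔ (λ h → subst (λ z → H z ≡ true) (\\-leftDividesʳ x y) (∙∈H _ _ (⁻¹∈H x hx) h)) (∙∈H x y hx))

    size-nonZero : NonZero (size H)
    size-nonZero = >-nonZero (∈-length (∈-filter⁺ (T? ∘ H) (complete ε) (subst T (sym ε∈H) tt)))

    _~_ : Carrier → Carrier → Bool
    x ~ y = H (x ⁻¹ ∙ y)

    ~-sym : ∀ x y → x ~ y ≡ y ~ x
    ~-sym x y = trans (sym (H-⁻¹ (x ⁻¹ ∙ y))) (cong H (⁻¹-anti-homo-\\ x y))

    ~-trans : ∀ {x y} z → x ~ y ≡ true → x ~ z ≡ y ~ z
    ~-trans {x} {y} z x~y = trans (cong H (sym through-y)) (H-∙ˡ (y ⁻¹ ∙ z) x~y)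
      where
      through-y : (x ⁻¹ ∙ y) ∙ (y ⁻¹ ∙ z) ≡ x ⁻¹ ∙ z
      through-y = trans (assoc _ _ _) (cong (x ⁻¹ ∙_) (\\-leftDividesˡ y z))

    ∑-coset-size : ∀ g → ∑[ x ∈ elems ] ⟦ g ~ x ⟧ ≡ size H
    ∑-coset-size g = trans (∑-reindex (g ⁻¹ ∙_) (g ∙_) (\\-leftDividesˡ g) (\\-leftDividesʳ g) (λ x → ⟦ H x ⟧))
                           (sym (length-filterᵇ H elems))

    ∑-coset : ∀ g (f : Carrier → ℕ) → (∀ {x y} → x ~ y ≡ true → f x ≡ f y) →
              ∑[ x ∈ elems ] (⟦ g ~ x ⟧ * f x) ≡ size H * f g
    ∑-coset g f f-const = begin
      ∑[ x ∈ elems ] (⟦ g ~ x ⟧ * f x)    ≡⟨ ∑-cong elems on-coset ⟩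
      ∑[ x ∈ elems ] (⟦ g ~ x ⟧ * f g)    ≡⟨ *-distribʳ-∑ (f g) elems _ ⟨
      ∑[ x ∈ elems ] ⟦ g ~ x ⟧ * f g      ≡⟨ cong (_* f g) (∑-coset-size g) ⟩
      size H * f g                        ∎
      where
      open ≡-Reasoning
      on-coset : ∀ x → ⟦ g ~ x ⟧ * f x ≡ ⟦ g ~ x ⟧ * f g
      on-coset x with g ~ x in g~x
      ... | true  = cong (1 *_) (sym (f-const g~x))
      ... | false = refl

    outside : Carrier → Carrier → ℕ
    outside g x = ⟦ not (g ~ x) ⟧

    ∑-by-coset : ∀ g (f : Carrier → ℕ) → (∀ {x y} → x ~ y ≡ true → f x ≡ f y) →
                 ∑ elems f ≡ size H * f g + ∑[ x ∈ elems ] (outside g x * f x)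
    ∑-by-coset g f f-const = trans (∑-partition elems (g ~_) f)
                                   (cong (_+ ∑[ x ∈ elems ] (outside g x * f x)) (∑-coset g f f-const))

    count-by-coset : ∀ g → order ≡ size H + ∑ elems (outside g)
    count-by-coset g = begin
      order
        ≡⟨ ∑-length elems ⟨
      ∑[ x ∈ elems ] 1
        ≡⟨ ∑-by-coset g (λ _ → 1) (λ _ → refl) ⟩
      size H * 1 + ∑[ x ∈ elems ] (outside g x * 1)
        ≡⟨ cong₂ _+_ (*-identityʳ _) (∑-cong elems (λ x → *-identityʳ _)) ⟩
      size H + ∑ elems (outside g) ∎
      where open ≡-Reasoning

    module _ (D : Carrier → Bool) where

      cosetCoeff≡∑ : ∀ g → cosetCoeff H D g ≡ ∑[ d ∈ elems ] (⟦ D d ⟧ * ⟦ g ~ d ⟧)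
      cosetCoeff≡∑ g = trans (length-filterᵇ _ elems) (∑-cong elems (λ d → ⟦⟧-∧ (D d) (g ~ d)))

      cosetCoeff-const : ∀ {x y} → x ~ y ≡ true → cosetCoeff H D x ≡ cosetCoeff H D y
      cosetCoeff-const {x} {y} x~y = begin
        cosetCoeff H D x
          ≡⟨ cosetCoeff≡∑ x ⟩
        ∑[ d ∈ elems ] (⟦ D d ⟧ * ⟦ x ~ d ⟧)
          ≡⟨ ∑-cong elems (λ d → cong (λ b → ⟦ D d ⟧ * ⟦ b ⟧) (~-trans d x~y)) ⟩
        ∑[ d ∈ elems ] (⟦ D d ⟧ * ⟦ y ~ d ⟧)
          ≡⟨ cosetCoeff≡∑ y ⟨
        cosetCoeff H D y ∎
        where open ≡-Reasoning

      ∑-cosetCoeff : ∑ elems (cosetCoeff H D) ≡ size H * size D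
      ∑-cosetCoeff = begin
        ∑[ x ∈ elems ] cosetCoeff H D x                       ≡⟨ ∑-cong elems cosetCoeff≡∑ ⟩
        ∑[ x ∈ elems ] ∑[ d ∈ elems ] (⟦ D d ⟧ * ⟦ x ~ d ⟧)   ≡⟨ ∑-comm elems elems _ ⟩
        ∑[ d ∈ elems ] ∑[ x ∈ elems ] (⟦ D d ⟧ * ⟦ x ~ d ⟧)   ≡⟨ ∑-cong elems per-element ⟩
        ∑[ d ∈ elems ] (size H * ⟦ D d ⟧)                     ≡⟨ *-distribˡ-∑ (size H) elems _ ⟨
        size H * ∑[ d ∈ elems ] ⟦ D d ⟧                       ≡⟨ cong (size H *_) (length-filterᵇ D elems) ⟨
        size H * size D                                       ∎
        where
        open ≡-Reasoning
        per-element : ∀ d → ∑[ x ∈ elems ] (⟦ D d ⟧ * ⟦ x ~ d ⟧) ≡ size H * ⟦ D d ⟧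
        per-element d = begin
          ∑[ x ∈ elems ] (⟦ D d ⟧ * ⟦ x ~ d ⟧)   ≡⟨ *-distribˡ-∑ ⟦ D d ⟧ elems _ ⟨
          ⟦ D d ⟧ * ∑[ x ∈ elems ] ⟦ x ~ d ⟧     ≡⟨ cong (⟦ D d ⟧ *_) (∑-cong elems (λ x → cong ⟦_⟧ (~-sym x d))) ⟩
          ⟦ D d ⟧ * ∑[ x ∈ elems ] ⟦ d ~ x ⟧     ≡⟨ cong (⟦ D d ⟧ *_) (∑-coset-size d) ⟩
          ⟦ D d ⟧ * size H                       ≡⟨ *-comm ⟦ D d ⟧ (size H) ⟩
          size H * ⟦ D d ⟧                       ∎

      ∑-cosetCoeff² : ∑[ x ∈ elems ] (cosetCoeff H D x * cosetCoeff H D x)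
                      ≡ size H * ∑[ d ∈ elems ] (⟦ D d ⟧ * cosetCoeff H D d)
      ∑-cosetCoeff² = begin
        ∑[ x ∈ elems ] (a x * a x)
          ≡⟨ ∑-cong elems (λ x → cong (_* a x) (cosetCoeff≡∑ x)) ⟩
        ∑[ x ∈ elems ] (∑[ d ∈ elems ] (⟦ D d ⟧ * ⟦ x ~ d ⟧) * a x)
          ≡⟨ ∑-cong elems (λ x → *-distribʳ-∑ (a x) elems _) ⟩
        ∑[ x ∈ elems ] ∑[ d ∈ elems ] (⟦ D d ⟧ * ⟦ x ~ d ⟧ * a x)
          ≡⟨ ∑-comm elems elems _ ⟩
        ∑[ d ∈ elems ] ∑[ x ∈ elems ] (⟦ D d ⟧ * ⟦ x ~ d ⟧ * a x)
          ≡⟨ ∑-cong elems (λ d → ∑-cong elems (flip-coset d)) ⟩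
        ∑[ d ∈ elems ] ∑[ x ∈ elems ] (⟦ D d ⟧ * (⟦ d ~ x ⟧ * a x)) ≡⟨ ∑-cong elems per-element ⟩
        ∑[ d ∈ elems ] (size H * (⟦ D d ⟧ * a d))
          ≡⟨ *-distribˡ-∑ (size H) elems _ ⟨
        size H * ∑[ d ∈ elems ] (⟦ D d ⟧ * a d) ∎
        where
        open ≡-Reasoning
        a : Carrier → ℕ
        a = cosetCoeff H D
        flip-coset : ∀ d x → ⟦ D d ⟧ * ⟦ x ~ d ⟧ * a x ≡ ⟦ D d ⟧ * (⟦ d ~ x ⟧ * a x)
        flip-coset d x = trans (*-assoc ⟦ D d ⟧ _ _) (cong (λ b → ⟦ D d ⟧ * (⟦ b ⟧ * a x)) (~-sym x d))
        per-element : ∀ d → ∑[ x ∈ elems ] (⟦ D d ⟧ * (⟦ d ~ x ⟧ * a x)) ≡ size H * (⟦ D d ⟧ * a d)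
        per-element d = begin
          ∑[ x ∈ elems ] (⟦ D d ⟧ * (⟦ d ~ x ⟧ * a x))   ≡⟨ *-distribˡ-∑ ⟦ D d ⟧ elems _ ⟨
          ⟦ D d ⟧ * ∑[ x ∈ elems ] (⟦ d ~ x ⟧ * a x)     ≡⟨ cong (⟦ D d ⟧ *_) (∑-coset d a cosetCoeff-const) ⟩
          ⟦ D d ⟧ * (size H * a d)                       ≡⟨ x*[y*z]≡y*[x*z] ⟦ D d ⟧ (size H) (a d) ⟩
          size H * (⟦ D d ⟧ * a d)                       ∎

      ∑-H-reps : ∑[ u ∈ elems ] (⟦ H u ⟧ * reps D u) ≡ ∑[ d ∈ elems ] (⟦ D d ⟧ * cosetCoeff H D d)
      ∑-H-reps = begin
        ∑[ u ∈ elems ] (⟦ H u ⟧ * reps D u)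
          ≡⟨ ∑-reps D (λ u → ⟦ H u ⟧) ⟩
        ∑[ d₁ ∈ elems ] ∑[ d₂ ∈ elems ] (⟦ D d₁ ⟧ * (⟦ D d₂ ⟧ * ⟦ H (d₁ ∙ d₂ ⁻¹) ⟧))
          ≡⟨ ∑-comm elems elems _ ⟩
        ∑[ d₂ ∈ elems ] ∑[ d₁ ∈ elems ] (⟦ D d₁ ⟧ * (⟦ D d₂ ⟧ * ⟦ H (d₁ ∙ d₂ ⁻¹) ⟧))
          ≡⟨ ∑-cong elems (λ d₂ → ∑-cong elems (λ d₁ → swap d₁ d₂)) ⟩
        ∑[ d₂ ∈ elems ] ∑[ d₁ ∈ elems ] (⟦ D d₂ ⟧ * (⟦ D d₁ ⟧ * ⟦ d₂ ~ d₁ ⟧))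
          ≡⟨ ∑-cong elems (λ d₂ → trans (cong (⟦ D d₂ ⟧ *_) (cosetCoeff≡∑ d₂)) (*-distribˡ-∑ ⟦ D d₂ ⟧ elems _)) ⟨
        ∑[ d ∈ elems ] (⟦ D d ⟧ * cosetCoeff H D d) ∎
        where
        open ≡-Reasoning
        swap : ∀ d₁ d₂ → ⟦ D d₁ ⟧ * (⟦ D d₂ ⟧ * ⟦ H (d₁ ∙ d₂ ⁻¹) ⟧) ≡ ⟦ D d₂ ⟧ * (⟦ D d₁ ⟧ * ⟦ d₂ ~ d₁ ⟧)
        swap d₁ d₂ = trans (x*[y*z]≡y*[x*z] ⟦ D d₁ ⟧ ⟦ D d₂ ⟧ _)
                           (cong (λ u → ⟦ D d₂ ⟧ * (⟦ D d₁ ⟧ * ⟦ H u ⟧)) (comm d₁ (d₂ ⁻¹)))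

      second-moment : ∀ g → size H * ∑[ d ∈ elems ] (⟦ D d ⟧ * cosetCoeff H D d)
                            ≡ size H * (cosetCoeff H D g * cosetCoeff H D g)
                              + ∑[ x ∈ elems ] (outside g x * (cosetCoeff H D x * cosetCoeff H D x))
      second-moment g = trans (sym ∑-cosetCoeff²)
        (∑-by-coset g _ (λ x~y → cong₂ _*_ (cosetCoeff-const x~y) (cosetCoeff-const x~y)))

      module _ {v k lam} (isDifferenceSet : IsDifferenceSet D v k lam) where
        open IsDifferenceSet isDifferenceSet

        first-moment : ∀ g → size H * k
                             ≡ size H * cosetCoeff H D g + ∑[ x ∈ elems ] (outside g x * cosetCoeff H D x)
        first-moment g = begin
          size H * k                   ≡⟨ cong (size H *_) size≡k ⟨
          size H * size D              ≡⟨ ∑-cosetCoeff ⟨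
          ∑ elems (cosetCoeff H D)     ≡⟨ ∑-by-coset g (cosetCoeff H D) cosetCoeff-const ⟩
          size H * cosetCoeff H D g + ∑[ x ∈ elems ] (outside g x * cosetCoeff H D x) ∎
          where open ≡-Reasoning

        -- The paper's ∑_{m ∈ G/H} a_m² = n + λ |H|.
        ∑-D-cosetCoeff : ∑[ d ∈ elems ] (⟦ D d ⟧ * cosetCoeff H D d) + lam ≡ lam * size H + k
        ∑-D-cosetCoeff = begin
          ∑[ d ∈ elems ] (⟦ D d ⟧ * cosetCoeff H D d) + lam
            ≡⟨ cong₂ _+_ ∑-H-reps (*-identityʳ lam) ⟨
          ∑[ u ∈ elems ] (⟦ H u ⟧ * reps D u) + lam * 1
            ≡⟨ cong (λ b → ∑[ u ∈ elems ] (⟦ H u ⟧ * reps D u) + lam * ⟦ b ⟧) ε∈H ⟨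
          ∑[ u ∈ elems ] (⟦ H u ⟧ * reps D u) + lam * ⟦ H ε ⟧
            ≡⟨ ∑-weighted-reps D isDifferenceSet (λ u → ⟦ H u ⟧) ⟩
          lam * ∑[ u ∈ elems ] ⟦ H u ⟧ + k * ⟦ H ε ⟧
            ≡⟨ cong₂ (λ t b → lam * t + k * ⟦ b ⟧) (length-filterᵇ H elems) (sym ε∈H) ⟨
          lam * size H + k * 1
            ≡⟨ cong (lam * size H +_) (*-identityʳ k) ⟩
          lam * size H + k ∎
          where open ≡-Reasoning

lemma3 : (G : FinAbGroup) → let open FinAbGroup G in
    (H : Carrier → Bool) → IsSubgroup H →
    (D : Carrier → Bool) → (v k lam : ℕ) → IsDifferenceSet D v k lam →
    (M : ℕ) → M * size H ≡ order →
    (g : Carrier) →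
      (M * cosetCoeff H D g ∸ k) ^ 2 ≤ (M ∸ 1) ^ 2 * (k ∸ lam)
lemma3 G H isSubgroup D v k lam isDS M M*s≡order g =
  coset-bound (size H) M (cosetCoeff H D g) k lam v _ _ _ _ {{size-nonZero isSubgroup}}
    (trans M*s≡order order≡v) (trans (sym order≡v) (count-by-coset isSubgroup g))
    (first-moment isSubgroup D isDS g) (second-moment isSubgroup D g)
    (cauchy-schwarz elems (outside isSubgroup g) (cosetCoeff H D))
    (∑-D-cosetCoeff isSubgroup D isDS) (k*k+lam≡lam*v+k D isDS) (k≤v D isDS)
  where
  open FinAbGroup G
  open DifferenceSets G
  open IsDifferenceSet isDS using (order≡v)
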